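{- Let $n\ge1$ and let $I$ be a finite set. Suppose that for each $i\in I$ we have $S_i\subseteq\mathbb{F}_2^n$ with $0\in S_i$ and $\#S_i\ge2$. If every tuple of vectors in $\prod_{i\in I}S_i$ is linearly dependent, then there exists $J\subseteq I$ such that the sumset $\sum_{j\in J}S_j$ is a nontrivial subspace of $\mathbb{F}_2^n$.
   Context: The sumset $\sum_{j\in J}S_j$ is $\{\sum_{j\in J}s_j: s_j\in S_j\}$. A tuple $(v_i)_{i\in I}$ is linearly independent if the $v_i$ are distinct... more precisely, if no nontrivial $\mathbb{F}_2$-linear combination $\sum_{i\in I}c_iv_i$ (with $c_i\in\mathbb{F}_2$ not all zero) vanishes. -}

module Defs where

open import Data.Nat using (ℕ; zero; suc)
open import Data.Bool using (Bool; true; false; _xor_; if_then_else_)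
open import Data.Fin using (Fin; zero; suc)
open import Data.Vec using (Vec; replicate; zipWith)
open import Data.Product using (Σ; ∃; _×_; _,_)
open import Relation.Binary.PropositionalEquality using (_≡_; _≢_)
open import Relation.Nullary using (¬_)

F2^ : ℕ → Set
F2^ n = Vec Bool n

0v : ∀ {n} → F2^ n
0v = replicate _ false

_⊕_ : ∀ {n} → F2^ n → F2^ n → F2^ n
_⊕_ = zipWith _xor_

_·_ : ∀ {n} → Bool → F2^ n → F2^ n
c · v = if c then v else 0v

Σv : ∀ {n m} → (Fin m → F2^ n) → F2^ n
Σv {m = zero}  f = 0v
Σv {m = suc m} f = f zero ⊕ Σv (λ i → f (suc i))

Subset : ℕ → Set
Subset n = F2^ n → Bool

_∈_ : ∀ {n} → F2^ n → Subset n → Set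
x ∈ S = S x ≡ true

AtLeastTwo : ∀ {n} → Subset n → Set
AtLeastTwo S = Σ _ λ x → Σ _ λ y → x ∈ S × y ∈ S × x ≢ y

LinIndependent : ∀ {n m} → (Fin m → F2^ n) → Set
LinIndependent v = ∀ (c : Fin _ → Bool) → Σv (λ i → c i · v i) ≡ 0v → ∀ i → c i ≡ false

-- Sumset Σ_{j ∈ J} S_j, with J ⊆ Fin m given by J : Fin m → Bool
-- (the summands s_j for j ∉ J are ignored).
InSumset : ∀ {n m} → (Fin m → Subset n) → (Fin m → Bool) → F2^ n → Set
InSumset S J x =
  Σ (Fin _ → F2^ _) λ s → (∀ j → J j ≡ true → s j ∈ S j) × x ≡ Σv (λ j → J j · s j)

-- A set P ⊆ 𝔽₂ⁿ is an 𝔽₂-subspace: contains 0 and is closed under addition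
-- (closure under scalars 0,1 then follows).
IsSubspace : ∀ {n} → (F2^ n → Set) → Set
IsSubspace P = P 0v × (∀ x y → P x → P y → P (x ⊕ y))

IsNontrivialSubspace : ∀ {n} → (F2^ n → Set) → Set
IsNontrivialSubspace P = IsSubspace P × Σ _ λ x → P x × x ≢ 0v

-- By Rado's theorem for the linear matroid 𝔽₂ⁿ, a family (Sᵢ) without an independent
-- transversal has a deficient subfamily K: every Sᵢ with i ∈ K lies in the span of fewer
-- than ∣ K ∣ vectors. Rado's theorem is proved modulo the span of a list U, by strong
-- induction on ∣ J ∣: pick j ∈ J and x ∈ Sⱼ outside span U, and recurse on J ∖ {j} modulo
-- x. An independent transversal there extends by x; otherwise some K ⊆ J ∖ {j} is spanned
-- modulo U by at most ∣ K ∣ vectors, and the two recursive calls on K modulo U and on J ∖ K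
-- modulo that span glue to an independent transversal or a deficient subfamily of J.
--
-- For a deficient K (chosen minimal by recursion), an independent transversal B of K ∖ {j}
-- already spans every Sᵢ with i ∈ K: one more vector would give ∣ K ∣ independent vectors in
-- the span of fewer than ∣ K ∣ vectors. As 0 ∈ Sᵢ, the sumset over K is then span B, a
-- subspace, and it is nontrivial because Sⱼ contains a nonzero vector.

module Submission where

open import Defs
open import Algebra.Bundles using (CommutativeSemigroup)
import Algebra.Properties.CommutativeSemigroup as CommutativeSemigroupProperties
open import Data.Bool using (Bool; true; false; _∧_; _∨_; _xor_; not; if_then_else_)
open import Data.Bool.Properties
  using (xor-comm; xor-assoc; xor-same; xor-identityˡ; xor-identityʳ; ∧-distribˡ-xor; ∧-zeroʳ; ¬-not; if-eta)
  renaming (_≟_ to _≟ᵇ_)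
open import Data.Empty using (⊥-elim)
open import Data.Fin using (Fin; zero; suc)
open import Data.Fin.Properties using (suc-injective; _≟_; any?)
open import Data.List using (List; []; _∷_; _++_; length)
open import Data.List.Properties using (length-++; ++-assoc)
open import Data.Nat using (ℕ; zero; suc; _+_; _≤_; _<_; z≤n; s≤s)
open import Data.Nat.Properties
  using (+-suc; +-comm; m≤n⇒m≤1+n; ≤-reflexive; ≤-<-trans; n<1+n; m<n+m; +-mono-<-≤; <⇒≱)
open import Data.Nat.Induction using (<-wellFounded)
open import Data.Product using (Σ; ∃; _×_; _,_)
open import Data.Sum using (_⊎_; inj₁; inj₂; [_,_]′)
open import Data.Vec using ([]; _∷_)
open import Data.Vec.Properties using (≡-dec; zipWith-comm; zipWith-assoc; zipWith-identityˡ; zipWith-identityʳ)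
import Data.Vec.Functional as Vector
open import Function using (_∘_)
open import Level using (0ℓ)
open import Relation.Binary.PropositionalEquality
open import Relation.Nullary using (¬_; Dec; yes; no; does; contradiction)
open import Relation.Nullary.Decidable
  using (_⊎-dec_; _×-dec_; ¬?; map′; dec-true; dec-false; decidable-stable)
open import Induction.WellFounded using (WellFounded; Acc; acc)
import Relation.Binary.Construct.On as On

private
  variable
    n m : ℕ

⊕-comm : (x y : F2^ n) → x ⊕ y ≡ y ⊕ x
⊕-comm = zipWith-comm xor-comm

⊕-assoc : (x y z : F2^ n) → (x ⊕ y) ⊕ z ≡ x ⊕ (y ⊕ z)
⊕-assoc = zipWith-assoc xor-assoc

⊕-identityˡ : (x : F2^ n) → 0v ⊕ x ≡ x
⊕-identityˡ = zipWith-identityˡ xor-identityˡ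

⊕-identityʳ : (x : F2^ n) → x ⊕ 0v ≡ x
⊕-identityʳ = zipWith-identityʳ xor-identityʳ

⊕-self : (x : F2^ n) → x ⊕ x ≡ 0v
⊕-self []      = refl
⊕-self (a ∷ x) = cong₂ _∷_ (xor-same a) (⊕-self x)

⊕-commutativeSemigroup : ℕ → CommutativeSemigroup 0ℓ 0ℓ
⊕-commutativeSemigroup n = record
  { _∙_                    = _⊕_ {n}
  ; isCommutativeSemigroup = record
    { isSemigroup = record
      { isMagma = record { isEquivalence = isEquivalence ; ∙-cong = cong₂ _⊕_ }
      ; assoc   = ⊕-assoc
      }
    ; comm        = ⊕-comm
    }
  }

open module ⊕-Properties {n} = CommutativeSemigroupProperties (⊕-commutativeSemigroup n)
  using (interchange; xy∙z≈xz∙y)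

⊕-cancelˡ : (x y : F2^ n) → x ⊕ (x ⊕ y) ≡ y
⊕-cancelˡ x y = begin
  x ⊕ (x ⊕ y)  ≡⟨ ⊕-assoc x x y ⟨
  (x ⊕ x) ⊕ y  ≡⟨ cong (_⊕ y) (⊕-self x) ⟩
  0v ⊕ y       ≡⟨ ⊕-identityˡ y ⟩
  y            ∎
  where open ≡-Reasoning

⊕-cancelʳ : (x y : F2^ n) → (x ⊕ y) ⊕ y ≡ x
⊕-cancelʳ x y = trans (⊕-assoc x y y) (trans (cong (x ⊕_) (⊕-self y)) (⊕-identityʳ x))

_≟ᵛ_ : (x y : F2^ n) → Dec (x ≡ y)
_≟ᵛ_ = ≡-dec _≟ᵇ_

·-distrib-xor : ∀ a b (x : F2^ n) → (a xor b) · x ≡ (a · x) ⊕ (b · x)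
·-distrib-xor true  true  x = sym (⊕-self x)
·-distrib-xor true  false x = sym (⊕-identityʳ x)
·-distrib-xor false true  x = sym (⊕-identityˡ x)
·-distrib-xor false false x = sym (⊕-identityˡ 0v)

F2^-any? : {P : F2^ n → Set} → (∀ x → Dec (P x)) → Dec (∃ P)
F2^-any? {n = zero}          P? = map′ ([] ,_) (λ { ([] , p) → p }) (P? [])
F2^-any? {n = suc n} {P = P} P? =
  map′ join split (F2^-any? (P? ∘ (true ∷_)) ⊎-dec F2^-any? (P? ∘ (false ∷_)))
  where
  join : ∃ (P ∘ (true ∷_)) ⊎ ∃ (P ∘ (false ∷_)) → ∃ P
  join (inj₁ (x , p)) = true ∷ x , p
  join (inj₂ (x , p)) = false ∷ x , p
  split : ∃ P → ∃ (P ∘ (true ∷_)) ⊎ ∃ (P ∘ (false ∷_))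
  split (true ∷ x , p)  = inj₁ (x , p)
  split (false ∷ x , p) = inj₂ (x , p)

Σv-cong : {f g : Fin m → F2^ n} → (∀ i → f i ≡ g i) → Σv f ≡ Σv g
Σv-cong {m = zero}  f≗g = refl
Σv-cong {m = suc m} f≗g = cong₂ _⊕_ (f≗g zero) (Σv-cong (f≗g ∘ suc))

Σv-⊕ : (f g : Fin m → F2^ n) → Σv f ⊕ Σv g ≡ Σv (λ i → f i ⊕ g i)
Σv-⊕ {m = zero}  f g = ⊕-identityˡ 0v
Σv-⊕ {m = suc m} f g = trans (interchange (f zero) (Σv (f ∘ suc)) (g zero) (Σv (g ∘ suc)))
                             (cong ((f zero ⊕ g zero) ⊕_) (Σv-⊕ (f ∘ suc) (g ∘ suc)))

Σv-0 : (f : Fin m → F2^ n) → (∀ i → f i ≡ 0v) → Σv f ≡ 0v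
Σv-0 {m = zero}  f f≡0 = refl
Σv-0 {m = suc m} f f≡0 = trans (cong₂ _⊕_ (f≡0 zero) (Σv-0 (f ∘ suc) (f≡0 ∘ suc))) (⊕-identityˡ 0v)

Σv-single : (f : Fin m → F2^ n) (j : Fin m) → (∀ i → i ≢ j → f i ≡ 0v) → Σv f ≡ f j
Σv-single f zero    f≡0 =
  trans (cong (f zero ⊕_) (Σv-0 (f ∘ suc) (λ i → f≡0 (suc i) λ ()))) (⊕-identityʳ (f zero))
Σv-single f (suc j) f≡0 =
  trans (cong₂ _⊕_ (f≡0 zero λ ()) (Σv-single (f ∘ suc) j (λ i i≢j → f≡0 (suc i) (i≢j ∘ suc-injective))))
        (⊕-identityˡ (f (suc j)))

-- Subsets of the index set, as characteristic functions

∧-elimˡ : ∀ a {b} → a ∧ b ≡ true → a ≡ true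
∧-elimˡ true _ = refl

∧-elimʳ : ∀ a {b} → a ∧ b ≡ true → b ≡ true
∧-elimʳ true b≡true = b≡true

⁅_⁆ : Fin m → Fin m → Bool
⁅ j ⁆ i = does (i ≟ j)

_∖_ : (J K : Fin m → Bool) → Fin m → Bool
(J ∖ K) i = not (K i) ∧ J i

_∪_ : (K L : Fin m → Bool) → Fin m → Bool
(K ∪ L) i = K i ∨ L i

_⊆_ : (K J : Fin m → Bool) → Set
K ⊆ J = ∀ i → K i ≡ true → J i ≡ true

⁅⁆-self : (j : Fin m) → ⁅ j ⁆ j ≡ true
⁅⁆-self j = dec-true (j ≟ j) refl

⁅⁆-other : {i j : Fin m} → i ≢ j → ⁅ j ⁆ i ≡ false
⁅⁆-other {i = i} {j} = dec-false (i ≟ j)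

⁅⁆⇒≡ : {i j : Fin m} → ⁅ j ⁆ i ≡ true → i ≡ j
⁅⁆⇒≡ {i = i} {j} e with i ≟ j
⁅⁆⇒≡ _  | yes i≡j = i≡j
⁅⁆⇒≡ () | no _

⁅⁆-⊆ : {J : Fin m → Bool} {j : Fin m} → J j ≡ true → ⁅ j ⁆ ⊆ J
⁅⁆-⊆ {J = J} j∈J i i∈⁅j⁆ = subst (λ k → J k ≡ true) (sym (⁅⁆⇒≡ i∈⁅j⁆)) j∈J

∖-⊆ : (J K : Fin m → Bool) → (J ∖ K) ⊆ J
∖-⊆ J K i = ∧-elimʳ (not (K i))

∈⊎∈∖ : (J K : Fin m → Bool) {i : Fin m} → J i ≡ true → K i ≡ true ⊎ (J ∖ K) i ≡ true
∈⊎∈∖ J K {i} i∈J with K i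
... | true  = inj₁ refl
... | false = inj₂ i∈J

bit : Bool → ℕ
bit b = if b then 1 else 0

∣_∣ : (Fin m → Bool) → ℕ
∣_∣ {m = zero}  J = 0
∣_∣ {m = suc m} J = bit (J zero) + ∣ J ∘ suc ∣

∣∣-cong : {J K : Fin m → Bool} → (∀ i → J i ≡ K i) → ∣ J ∣ ≡ ∣ K ∣
∣∣-cong {m = zero}  J≗K = refl
∣∣-cong {m = suc m} J≗K = cong₂ _+_ (cong bit (J≗K zero)) (∣∣-cong (J≗K ∘ suc))

∣∣-empty : (J : Fin m → Bool) → (∀ i → J i ≡ false) → ∣ J ∣ ≡ 0
∣∣-empty {m = zero}  J J≡∅ = refl
∣∣-empty {m = suc m} J J≡∅ = cong₂ _+_ (cong bit (J≡∅ zero)) (∣∣-empty (J ∘ suc) (J≡∅ ∘ suc))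

∣⁅⁆∣ : (j : Fin m) → ∣ ⁅ j ⁆ ∣ ≡ 1
∣⁅⁆∣ {m = suc m} zero = cong suc (∣∣-empty {m = m} (λ _ → false) (λ _ → refl))
∣⁅⁆∣ (suc j)        = ∣⁅⁆∣ j

∣∣-mono : {K J : Fin m → Bool} → K ⊆ J → ∣ K ∣ ≤ ∣ J ∣
∣∣-mono {m = zero}          K⊆J = z≤n
∣∣-mono {m = suc m} {K} {J} K⊆J = step (K zero) (J zero) (K⊆J zero) (∣∣-mono (K⊆J ∘ suc))
  where
  step : ∀ a b {x y} → (a ≡ true → b ≡ true) → x ≤ y → bit a + x ≤ bit b + y
  step true  true  _   x≤y = s≤s x≤y
  step true  false a⇒b _   = contradiction (a⇒b refl) λ ()
  step false true  _   x≤y = m≤n⇒m≤1+n x≤y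
  step false false _   x≤y = x≤y

∣∣-∪ : {K L : Fin m → Bool} → (∀ i → K i ≡ true → L i ≡ false) → ∣ K ∪ L ∣ ≡ ∣ K ∣ + ∣ L ∣
∣∣-∪ {m = zero}          disjoint = refl
∣∣-∪ {m = suc m} {K} {L} disjoint = step (K zero) (L zero) (disjoint zero) (∣∣-∪ (disjoint ∘ suc))
  where
  step : ∀ a b {x y z} → (a ≡ true → b ≡ false) → x ≡ y + z → bit (a ∨ b) + x ≡ (bit a + y) + (bit b + z)
  step true  true                 a⇒¬b _     = contradiction (a⇒¬b refl) λ ()
  step true  false                _    x≡y+z = cong suc x≡y+z
  step false true  {y = y} {z = z} _    x≡y+z = trans (cong suc x≡y+z) (sym (+-suc y z))
  step false false                _    x≡y+z = x≡y+z

∣∣-partition : {K J : Fin m → Bool} → K ⊆ J → ∣ J ∣ ≡ ∣ K ∣ + ∣ J ∖ K ∣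
∣∣-partition {K = K} {J} K⊆J = trans (∣∣-cong split) (∣∣-∪ disjoint)
  where
  split : ∀ i → J i ≡ (K ∪ (J ∖ K)) i
  split i with K i in i∈K
  ... | true  = K⊆J i i∈K
  ... | false = refl
  disjoint : ∀ i → K i ≡ true → (J ∖ K) i ≡ false
  disjoint i i∈K rewrite i∈K = refl

∣∣-remove : (J : Fin m → Bool) {j : Fin m} → J j ≡ true → ∣ J ∣ ≡ suc ∣ J ∖ ⁅ j ⁆ ∣
∣∣-remove J {j} j∈J = trans (∣∣-partition (⁅⁆-⊆ {J = J} j∈J)) (cong (_+ ∣ J ∖ ⁅ j ⁆ ∣) (∣⁅⁆∣ j))

InSpan : List (F2^ n) → F2^ n → Set
InSpan []      x = x ≡ 0v
InSpan (t ∷ U) x = InSpan U x ⊎ InSpan U (x ⊕ t)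

span? : (U : List (F2^ n)) (x : F2^ n) → Dec (InSpan U x)
span? []      x = x ≟ᵛ 0v
span? (t ∷ U) x = span? U x ⊎-dec span? U (x ⊕ t)

span-0 : (U : List (F2^ n)) → InSpan U 0v
span-0 []      = refl
span-0 (t ∷ U) = inj₁ (span-0 U)

span-⊕ : (U : List (F2^ n)) {x y : F2^ n} → InSpan U x → InSpan U y → InSpan U (x ⊕ y)
span-⊕ []      refl refl = ⊕-identityˡ 0v
span-⊕ (t ∷ U) (inj₁ x∈U) (inj₁ y∈U) = inj₁ (span-⊕ U x∈U y∈U)
span-⊕ (t ∷ U) {x} {y} (inj₁ x∈U) (inj₂ y+t∈U) =
  inj₂ (subst (InSpan U) (sym (⊕-assoc x y t)) (span-⊕ U x∈U y+t∈U))
span-⊕ (t ∷ U) {x} {y} (inj₂ x+t∈U) (inj₁ y∈U) =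
  inj₂ (subst (InSpan U) (xy∙z≈xz∙y x t y) (span-⊕ U x+t∈U y∈U))
span-⊕ (t ∷ U) {x} {y} (inj₂ x+t∈U) (inj₂ y+t∈U) =
  inj₁ (subst (InSpan U) t+t-cancels (span-⊕ U x+t∈U y+t∈U))
  where
  t+t-cancels : (x ⊕ t) ⊕ (y ⊕ t) ≡ x ⊕ y
  t+t-cancels = begin
    (x ⊕ t) ⊕ (y ⊕ t)  ≡⟨ interchange x t y t ⟩
    (x ⊕ y) ⊕ (t ⊕ t)  ≡⟨ cong ((x ⊕ y) ⊕_) (⊕-self t) ⟩
    (x ⊕ y) ⊕ 0v       ≡⟨ ⊕-identityʳ (x ⊕ y) ⟩
    x ⊕ y              ∎
    where open ≡-Reasoning

span-head : (t : F2^ n) (U : List (F2^ n)) → InSpan (t ∷ U) t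
span-head t U = inj₂ (subst (InSpan U) (sym (⊕-self t)) (span-0 U))

span-absorb : (U : List (F2^ n)) {t x : F2^ n} → InSpan U t → InSpan (t ∷ U) x → InSpan U x
span-absorb U t∈U (inj₁ x∈U)           = x∈U
span-absorb U {t} {x} t∈U (inj₂ x+t∈U) = subst (InSpan U) (⊕-cancelʳ x t) (span-⊕ U x+t∈U t∈U)

span-++ʳ : (T : List (F2^ n)) {U : List (F2^ n)} {x : F2^ n} → InSpan U x → InSpan (T ++ U) x
span-++ʳ []      x∈U = x∈U
span-++ʳ (t ∷ T) x∈U = inj₁ (span-++ʳ T x∈U)

span-move : (T : List (F2^ n)) {U : List (F2^ n)} {t x : F2^ n} →
            InSpan (t ∷ T ++ U) x → InSpan (T ++ t ∷ U) x
span-move []      x∈ = x∈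
span-move (s ∷ T) (inj₁ (inj₁ x∈))     = inj₁ (span-move T (inj₁ x∈))
span-move (s ∷ T) (inj₁ (inj₂ x+s∈))   = inj₂ (span-move T (inj₁ x+s∈))
span-move (s ∷ T) (inj₂ (inj₁ x+t∈))   = inj₁ (span-move T (inj₂ x+t∈))
span-move (s ∷ T) {U} {t} {x} (inj₂ (inj₂ x+t+s∈)) =
  inj₂ (span-move T (inj₂ (subst (InSpan (T ++ U)) (xy∙z≈xz∙y x t s) x+t+s∈)))

span-· : (U : List (F2^ n)) (a : Bool) {x : F2^ n} → (a ≡ true → InSpan U x) → InSpan U (a · x)
span-· U true  x∈U = x∈U refl
span-· U false _   = span-0 U

span-Σv : (U : List (F2^ n)) (f : Fin m → F2^ n) → (∀ i → InSpan U (f i)) → InSpan U (Σv f)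
span-Σv {m = zero}  U f f∈U = span-0 U
span-Σv {m = suc m} U f f∈U = span-⊕ U (f∈U zero) (span-Σv U (f ∘ suc) (f∈U ∘ suc))

lincomb : (J c : Fin m → Bool) → (Fin m → F2^ n) → F2^ n
lincomb J c v = Σv (λ i → (J i ∧ c i) · v i)

members : (Fin m → Bool) → (Fin m → F2^ n) → List (F2^ n)
members {m = zero}  J v = []
members {m = suc m} J v = if J zero then v zero ∷ rest else rest
  where rest = members (J ∘ suc) (v ∘ suc)

mix : (K : Fin m → Bool) → (w z : Fin m → F2^ n) → Fin m → F2^ n
mix K w z i = if K i then w i else z i

lincomb-0 : (J c : Fin m → Bool) (v : Fin m → F2^ n) → (∀ i → J i ≡ true → c i ≡ false) → lincomb J c v ≡ 0v
lincomb-0 J c v c≡0 = Σv-0 _ term≡0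
  where
  term≡0 : ∀ i → (J i ∧ c i) · v i ≡ 0v
  term≡0 i with J i in i∈J
  ... | true  rewrite c≡0 i i∈J = refl
  ... | false = refl

lincomb-single : (J : Fin m → Bool) (v : Fin m → F2^ n) {i : Fin m} → J i ≡ true → lincomb J ⁅ i ⁆ v ≡ v i
lincomb-single J v {i} i∈J = trans (Σv-single _ i other≡0) (cong (_· v i) J∧⁅i⁆≡true)
  where
  other≡0 : ∀ k → k ≢ i → (J k ∧ ⁅ i ⁆ k) · v k ≡ 0v
  other≡0 k k≢i rewrite ⁅⁆-other k≢i | ∧-zeroʳ (J k) = refl
  J∧⁅i⁆≡true : J i ∧ ⁅ i ⁆ i ≡ true
  J∧⁅i⁆≡true rewrite i∈J = ⁅⁆-self i

lincomb-⊕ : (J c d : Fin m → Bool) (v : Fin m → F2^ n) →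
            lincomb J c v ⊕ lincomb J d v ≡ lincomb J (λ i → c i xor d i) v
lincomb-⊕ J c d v = trans (Σv-⊕ (λ i → (J i ∧ c i) · v i) (λ i → (J i ∧ d i) · v i)) (Σv-cong term)
  where
  term : ∀ i → ((J i ∧ c i) · v i) ⊕ ((J i ∧ d i) · v i) ≡ (J i ∧ (c i xor d i)) · v i
  term i = sym (trans (cong (_· v i) (∧-distribˡ-xor (J i) (c i) (d i))) (·-distrib-xor _ _ (v i)))

lincomb-restrict : {K J : Fin m → Bool} (c : Fin m → Bool) (v : Fin m → F2^ n) →
                   K ⊆ J → lincomb K c v ≡ lincomb J (λ i → K i ∧ c i) v
lincomb-restrict {K = K} {J} c v K⊆J = Σv-cong term
  where
  term : ∀ i → (K i ∧ c i) · v i ≡ (J i ∧ (K i ∧ c i)) · v i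
  term i with K i in i∈K
  ... | true  rewrite K⊆J i i∈K = refl
  ... | false rewrite ∧-zeroʳ (J i) = refl

lincomb-mix : {K J : Fin m → Bool} (c : Fin m → Bool) (w z : Fin m → F2^ n) → K ⊆ J →
              lincomb J c (mix K w z) ≡ lincomb K c w ⊕ lincomb (J ∖ K) c z
lincomb-mix {K = K} {J} c w z K⊆J =
  trans (Σv-cong term) (sym (Σv-⊕ (λ i → (K i ∧ c i) · w i) (λ i → ((J ∖ K) i ∧ c i) · z i)))
  where
  term : ∀ i → (J i ∧ c i) · mix K w z i ≡ ((K i ∧ c i) · w i) ⊕ (((J ∖ K) i ∧ c i) · z i)
  term i with K i in i∈K
  ... | true  rewrite K⊆J i i∈K = sym (⊕-identityʳ _)
  ... | false = sym (⊕-identityˡ _)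

lincomb-const : (L c : Fin m → Bool) (x : F2^ n) {j : Fin m} → (∀ i → L i ≡ true → i ≡ j) →
                lincomb L c (λ _ → x) ≡ (L j ∧ c j) · x
lincomb-const L c x {j} L⊆⁅j⁆ = Σv-single _ j other≡0
  where
  other≡0 : ∀ i → i ≢ j → (L i ∧ c i) · x ≡ 0v
  other≡0 i i≢j with L i in i∈L
  ... | true  = contradiction (L⊆⁅j⁆ i i∈L) i≢j
  ... | false = refl

span-lincomb : (U : List (F2^ n)) (J c : Fin m → Bool) (v : Fin m → F2^ n) →
               (∀ i → J i ≡ true → InSpan U (v i)) → InSpan U (lincomb J c v)
span-lincomb U J c v v∈U = span-Σv U _ (λ i → span-· U (J i ∧ c i) (v∈U i ∘ ∧-elimˡ (J i)))

span-members⁺ : (J c : Fin m → Bool) (v : Fin m → F2^ n) {U : List (F2^ n)} {x : F2^ n} →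
                InSpan U (x ⊕ lincomb J c v) → InSpan (members J v ++ U) x
span-members⁺ {m = zero}  J c v {U} {x} x∈U = subst (InSpan U) (⊕-identityʳ x) x∈U
span-members⁺ {m = suc m} J c v {U} =
  step (J zero) (c zero) (span-members⁺ (J ∘ suc) (c ∘ suc) (v ∘ suc))
  where
  rest = members (J ∘ suc) (v ∘ suc)
  y    = lincomb (J ∘ suc) (c ∘ suc) (v ∘ suc)
  step : ∀ a b {x} → (∀ {x′} → InSpan U (x′ ⊕ y) → InSpan (rest ++ U) x′) →
         InSpan U (x ⊕ (((a ∧ b) · v zero) ⊕ y)) → InSpan ((if a then v zero ∷ rest else rest) ++ U) x
  step true  true  {x} ih x∈ = inj₂ (ih (subst (InSpan U) (sym (⊕-assoc x (v zero) y)) x∈))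
  step true  false {x} ih x∈ = inj₁ (ih (subst (InSpan U) (cong (x ⊕_) (⊕-identityˡ y)) x∈))
  step false _     {x} ih x∈ = ih (subst (InSpan U) (cong (x ⊕_) (⊕-identityˡ y)) x∈)

span-members⁻ : (J : Fin m → Bool) (v : Fin m → F2^ n) {U : List (F2^ n)} {x : F2^ n} →
                InSpan (members J v ++ U) x → ∃ λ c → InSpan U (x ⊕ lincomb J c v)
span-members⁻ {m = zero}  J v {U} {x} x∈ = (λ ()) , subst (InSpan U) (sym (⊕-identityʳ x)) x∈
span-members⁻ {m = suc m} J v {U} = step (J zero) (span-members⁻ (J ∘ suc) (v ∘ suc))
  where
  rest = members (J ∘ suc) (v ∘ suc)
  y : (Fin m → Bool) → F2^ _
  y c = lincomb (J ∘ suc) c (v ∘ suc)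
  step : ∀ a {x} → (∀ {x′} → InSpan (rest ++ U) x′ → ∃ λ c → InSpan U (x′ ⊕ y c)) →
         InSpan ((if a then v zero ∷ rest else rest) ++ U) x →
         ∃ λ c → InSpan U (x ⊕ (((a ∧ c zero) · v zero) ⊕ y (c ∘ suc)))
  step true {x} ih (inj₁ x∈) with ih x∈
  ... | c , x∈U = false Vector.∷ c , subst (InSpan U) (cong (x ⊕_) (sym (⊕-identityˡ (y c)))) x∈U
  step true {x} ih (inj₂ x+v∈) with ih x+v∈
  ... | c , x+v∈U = true Vector.∷ c , subst (InSpan U) (⊕-assoc x (v zero) (y c)) x+v∈U
  step false {x} ih x∈ with ih x∈
  ... | c , x∈U = false Vector.∷ c , subst (InSpan U) (cong (x ⊕_) (sym (⊕-identityˡ (y c)))) x∈U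

-- Independence modulo a span

IndependentMod : List (F2^ n) → (Fin m → Bool) → (Fin m → F2^ n) → Set
IndependentMod U J v = ∀ c → InSpan U (lincomb J c v) → ∀ i → J i ≡ true → c i ≡ false

independent-⊆ : {U : List (F2^ n)} {K J : Fin m → Bool} {v : Fin m → F2^ n} →
                K ⊆ J → IndependentMod U J v → IndependentMod U K v
independent-⊆ {U = U} {K} {J} {v} K⊆J ind c Σ∈U i i∈K =
  subst (λ b → b ∧ c i ≡ false) i∈K
    (ind (λ k → K k ∧ c k) (subst (InSpan U) (lincomb-restrict c v K⊆J) Σ∈U) i (K⊆J i i∈K))

independent-const : {U : List (F2^ n)} (L : Fin m → Bool) {x : F2^ n} {j : Fin m} →
                    (∀ i → L i ≡ true → i ≡ j) → ¬ InSpan U x → IndependentMod U L (λ _ → x)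
independent-const {U = U} L {x} L⊆⁅j⁆ x∉U c Σ∈U i i∈L with refl ← L⊆⁅j⁆ i i∈L =
  ¬-not λ i∈c → x∉U (subst (InSpan U) (trans (lincomb-const L c x L⊆⁅j⁆)
                                             (cong₂ (λ a b → (a ∧ b) · x) i∈L i∈c)) Σ∈U)

independent-mix : (T U : List (F2^ n)) {K J : Fin m → Bool} {w z : Fin m → F2^ n} → K ⊆ J →
                  IndependentMod U K w → IndependentMod (T ++ U) (J ∖ K) z →
                  (∀ i → K i ≡ true → InSpan (T ++ U) (w i)) → IndependentMod U J (mix K w z)
independent-mix T U {K} {J} {w} {z} K⊆J w-ind z-ind w∈ c Σ∈U i i∈J =
  [ c-on-K i , c-off-K i ]′ (∈⊎∈∖ J K i∈J)
  where
  A = lincomb K c w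
  B = lincomb (J ∖ K) c z
  split = lincomb-mix c w z K⊆J
  c-off-K : ∀ i → (J ∖ K) i ≡ true → c i ≡ false
  c-off-K = z-ind c (subst (InSpan (T ++ U)) (trans (cong (A ⊕_) split) (⊕-cancelˡ A B))
                      (span-⊕ (T ++ U) (span-lincomb (T ++ U) K c w w∈) (span-++ʳ T Σ∈U)))
  c-on-K : ∀ i → K i ≡ true → c i ≡ false
  c-on-K = w-ind c (subst (InSpan U) (trans split (trans (cong (A ⊕_) (lincomb-0 (J ∖ K) c z c-off-K))
                                                         (⊕-identityʳ A))) Σ∈U)

independent-extend : {U : List (F2^ n)} {J : Fin m → Bool} {v : Fin m → F2^ n} {t : F2^ n} →
                     ¬ InSpan (members J v ++ U) t → IndependentMod U J v → IndependentMod (t ∷ U) J v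
independent-extend             t∉ ind c (inj₁ Σ∈U)   = ind c Σ∈U
independent-extend {U = U} {J} {v} {t} t∉ ind c (inj₂ Σ+t∈U) =
  ⊥-elim (t∉ (span-members⁺ J c v (subst (InSpan U) (⊕-comm (lincomb J c v) t) Σ+t∈U)))

independent-exchange : {U : List (F2^ n)} {J c : Fin m → Bool} {v : Fin m → F2^ n} {t : F2^ n} {i₀ : Fin m} →
                       IndependentMod U J v → InSpan U (t ⊕ lincomb J c v) → J i₀ ≡ true → c i₀ ≡ true →
                       IndependentMod (t ∷ U) (J ∖ ⁅ i₀ ⁆) v
independent-exchange {J = J} {i₀ = i₀} ind _ _ _ d (inj₁ Σ∈U) =
  independent-⊆ (∖-⊆ J ⁅ i₀ ⁆) ind d Σ∈U
independent-exchange {U = U} {J} {c} {v} {t} {i₀} ind t+Σ∈U i₀∈J i₀∈c d (inj₂ Σ+t∈U) _ _ =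
  contradiction (trans (sym i₀∈c) (trans (sym e-i₀≡c-i₀) e-i₀≡false)) λ ()
  where
  K = J ∖ ⁅ i₀ ⁆
  e = λ i → (K i ∧ d i) xor c i
  L = lincomb J c v
  sum≡ : (lincomb K d v ⊕ t) ⊕ (t ⊕ L) ≡ lincomb J e v
  sum≡ = begin
    (lincomb K d v ⊕ t) ⊕ (t ⊕ L)              ≡⟨ ⊕-assoc (lincomb K d v) t (t ⊕ L) ⟩
    lincomb K d v ⊕ (t ⊕ (t ⊕ L))              ≡⟨ cong (lincomb K d v ⊕_) (⊕-cancelˡ t L) ⟩
    lincomb K d v ⊕ L                          ≡⟨ cong (_⊕ L) (lincomb-restrict d v (∖-⊆ J ⁅ i₀ ⁆)) ⟩
    lincomb J (λ i → K i ∧ d i) v ⊕ L          ≡⟨ lincomb-⊕ J (λ i → K i ∧ d i) c v ⟩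
    lincomb J e v                              ∎
    where open ≡-Reasoning
  e-i₀≡false : e i₀ ≡ false
  e-i₀≡false = ind e (subst (InSpan U) sum≡ (span-⊕ U Σ+t∈U t+Σ∈U)) i₀ i₀∈J
  e-i₀≡c-i₀ : e i₀ ≡ c i₀
  e-i₀≡c-i₀ rewrite ⁅⁆-self i₀ = refl

dimension-bound : (T U : List (F2^ n)) (J : Fin m → Bool) (v : Fin m → F2^ n) → IndependentMod U J v →
                  (∀ i → J i ≡ true → InSpan (T ++ U) (v i)) → ∣ J ∣ ≤ length T
dimension-bound [] U J v ind v∈U = ≤-reflexive (∣∣-empty J J-empty)
  where
  J-empty : ∀ i → J i ≡ false
  J-empty i = ¬-not λ i∈J → contradiction
    (trans (sym (⁅⁆-self i)) (ind ⁅ i ⁆ (subst (InSpan U) (sym (lincomb-single J v i∈J)) (v∈U i i∈J)) i i∈J)) λ ()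
-- Steinitz exchange: the head t of T is either independent of v modulo U, or lies in span U,
-- or can be exchanged against some vᵢ₀.
dimension-bound (t ∷ T) U J v ind v∈ with span? (members J v ++ U) t
... | no t∉ = m≤n⇒m≤1+n
  (dimension-bound T (t ∷ U) J v (independent-extend t∉ ind) (λ i i∈J → span-move T (v∈ i i∈J)))
... | yes t∈ with span-members⁻ J v t∈
...   | c , t+Σ∈U with any? (λ i → (J i ≟ᵇ true) ×-dec (c i ≟ᵇ true))
...     | no c-vanishes = m≤n⇒m≤1+n
  (dimension-bound T U J v ind (λ i i∈J → span-absorb (T ++ U) (span-++ʳ T t∈U) (v∈ i i∈J)))
  where
  Σ≡0 : lincomb J c v ≡ 0v
  Σ≡0 = lincomb-0 J c v λ i i∈J → ¬-not λ i∈c → c-vanishes (i , i∈J , i∈c)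
  t∈U : InSpan U t
  t∈U = subst (InSpan U) (trans (cong (t ⊕_) Σ≡0) (⊕-identityʳ t)) t+Σ∈U
...     | yes (i₀ , i₀∈J , i₀∈c) = subst (_≤ suc (length T)) (sym (∣∣-remove J i₀∈J))
  (s≤s (dimension-bound T (t ∷ U) (J ∖ ⁅ i₀ ⁆) v (independent-exchange ind t+Σ∈U i₀∈J i₀∈c)
                        (λ i i∈ → span-move T (v∈ i (∖-⊆ J ⁅ i₀ ⁆ i i∈)))))

-- Rado's theorem for subsets of 𝔽₂ⁿ

_≺_ : (K J : Fin m → Bool) → Set
K ≺ J = ∣ K ∣ < ∣ J ∣

≺-wellFounded : WellFounded (_≺_ {m = m})
≺-wellFounded = On.wellFounded ∣_∣ <-wellFounded

∖⁅⁆-≺ : (J : Fin m → Bool) {j : Fin m} → J j ≡ true → (J ∖ ⁅ j ⁆) ≺ J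
∖⁅⁆-≺ J {j} j∈J = subst (∣ J ∖ ⁅ j ⁆ ∣ <_) (sym (∣∣-remove J j∈J)) (n<1+n _)

module _ (S : Fin m → Subset n) where

  IsTransversal : (Fin m → Bool) → (Fin m → F2^ n) → Set
  IsTransversal J v = ∀ i → J i ≡ true → v i ∈ S i

  Spans : List (F2^ n) → (Fin m → Bool) → Set
  Spans U K = ∀ i → K i ≡ true → ∀ x → x ∈ S i → InSpan U x

  IndependentTransversal : List (F2^ n) → (Fin m → Bool) → Set
  IndependentTransversal U J = ∃ λ v → IsTransversal J v × IndependentMod U J v

  Deficient : List (F2^ n) → (Fin m → Bool) → Set
  Deficient U K = ∃ λ T → length T < ∣ K ∣ × Spans (T ++ U) K

  RadoAlternative : List (F2^ n) → (Fin m → Bool) → Set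
  RadoAlternative U J = IndependentTransversal U J ⊎ ∃ λ K → K ⊆ J × Deficient U K

  mix-transversal : {K J : Fin m → Bool} {w z : Fin m → F2^ n} →
                    IsTransversal K w → IsTransversal (J ∖ K) z → IsTransversal J (mix K w z)
  mix-transversal {K} {J} w∈ z∈ i i∈J with K i in i∈K
  ... | true  = w∈ i i∈K
  ... | false = z∈ i (subst (λ b → not b ∧ J i ≡ true) (sym i∈K) i∈J)

  rado-combine : (T U : List (F2^ n)) {K J : Fin m → Bool} → K ⊆ J → length T ≤ ∣ K ∣ → Spans (T ++ U) K →
                 RadoAlternative U K → RadoAlternative (T ++ U) (J ∖ K) → RadoAlternative U J
  rado-combine T U K⊆J _ _ (inj₂ (K′ , K′⊆K , K′-deficient)) _ =
    inj₂ (K′ , (λ i → K⊆J i ∘ K′⊆K i) , K′-deficient)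
  rado-combine T U K⊆J _ K-spanned (inj₁ (w , w∈ , w-ind)) (inj₁ (z , z∈ , z-ind)) =
    inj₁ (mix _ w z , mix-transversal w∈ z∈ ,
          independent-mix T U K⊆J w-ind z-ind (λ i i∈K → K-spanned i i∈K (w i) (w∈ i i∈K)))
  rado-combine T U {K} {J} K⊆J tight K-spanned (inj₁ _) (inj₂ (K′ , K′⊆J∖K , T′ , short , K′-spanned)) =
    inj₂ (K ∪ K′ , K∪K′⊆J , T′ ++ T , shorter , K∪K′-spanned)
    where
    disjoint : ∀ i → K i ≡ true → K′ i ≡ false
    disjoint i i∈K = ¬-not λ i∈K′ →
      contradiction (trans (cong (λ b → not b ∧ J i) (sym i∈K)) (K′⊆J∖K i i∈K′)) λ ()
    K∪K′⊆J : (K ∪ K′) ⊆ J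
    K∪K′⊆J i i∈ with K i in i∈K
    ... | true  = K⊆J i i∈K
    ... | false = ∖-⊆ J K i (K′⊆J∖K i i∈)
    shorter : length (T′ ++ T) < ∣ K ∪ K′ ∣
    shorter = subst₂ _<_ (sym (length-++ T′)) (trans (+-comm ∣ K′ ∣ ∣ K ∣) (sym (∣∣-∪ disjoint)))
                     (+-mono-<-≤ short tight)
    K∪K′-spanned : Spans ((T′ ++ T) ++ U) (K ∪ K′)
    K∪K′-spanned i i∈ x x∈S rewrite ++-assoc T′ T U with K i in i∈K
    ... | true  = span-++ʳ T′ (K-spanned i i∈K x x∈S)
    ... | false = K′-spanned i i∈ x x∈S

  rado : (J : Fin m → Bool) → Acc _≺_ J → (U : List (F2^ n)) → RadoAlternative U J
  rado J (acc smaller) U with any? (λ j → J j ≟ᵇ true)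
  ... | no J-empty = inj₁ ((λ _ → 0v) , (λ i i∈J → contradiction (i , i∈J) J-empty)
                                      , (λ _ _ i i∈J → contradiction (i , i∈J) J-empty))
  ... | yes (j , j∈J) with F2^-any? (λ x → (S j x ≟ᵇ true) ×-dec ¬? (span? U x))
  ...   | no S-j⊆U = inj₂ (⁅ j ⁆ , ⁅⁆-⊆ j∈J , [] , subst (0 <_) (sym (∣⁅⁆∣ j)) (s≤s z≤n) , ⁅j⁆-spanned)
    where
    ⁅j⁆-spanned : Spans U ⁅ j ⁆
    ⁅j⁆-spanned i i∈⁅j⁆ x x∈S with refl ← ⁅⁆⇒≡ {i = i} {j} i∈⁅j⁆ =
      decidable-stable (span? U x) λ x∉U → S-j⊆U (x , x∈S , x∉U)
  ...   | yes (x , x∈S , x∉U) with rado (J ∖ ⁅ j ⁆) (smaller (∖⁅⁆-≺ J j∈J)) (x ∷ U)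
  ...     | inj₁ (v , v∈ , v-ind) =
    inj₁ (mix ⁅ j ⁆ (λ _ → x) v , mix-transversal x-transversal v∈ ,
          independent-mix (x ∷ []) U (⁅⁆-⊆ j∈J) (independent-const ⁅ j ⁆ (λ i → ⁅⁆⇒≡ {i = i} {j}) x∉U) v-ind
                          (λ _ _ → span-head x U))
    where
    x-transversal : IsTransversal ⁅ j ⁆ (λ _ → x)
    x-transversal i i∈⁅j⁆ = subst (λ k → x ∈ S k) (sym (⁅⁆⇒≡ {i = i} {j} i∈⁅j⁆)) x∈S
  ...     | inj₂ (K , K⊆J∖⁅j⁆ , T , short , K-spanned) =
    rado-combine T⁺ U K⊆J tight (subst (λ L → Spans L K) (sym (++-assoc T (x ∷ []) U)) K-spanned)
                 (rado K (smaller K≺J) U) (rado (J ∖ K) (smaller J∖K≺J) (T⁺ ++ U))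
    where
    -- T spans K modulo x ∷ U, so T ++ [x] spans K modulo U with at most ∣ K ∣ vectors.
    T⁺ = T ++ x ∷ []
    K⊆J : K ⊆ J
    K⊆J i = ∖-⊆ J ⁅ j ⁆ i ∘ K⊆J∖⁅j⁆ i
    tight : length T⁺ ≤ ∣ K ∣
    tight = subst (_≤ ∣ K ∣) (sym (trans (length-++ T) (+-comm (length T) 1))) short
    K≺J : K ≺ J
    K≺J = ≤-<-trans (∣∣-mono K⊆J∖⁅j⁆) (∖⁅⁆-≺ J j∈J)
    J∖K≺J : (J ∖ K) ≺ J
    J∖K≺J = subst (∣ J ∖ K ∣ <_) (sym (∣∣-partition K⊆J)) (m<n+m ∣ J ∖ K ∣ (≤-<-trans z≤n short))

-- Sumsets of a family with 0 ∈ Sᵢ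

⊕≡0⇒≡ : {x y : F2^ n} → x ⊕ y ≡ 0v → x ≡ y
⊕≡0⇒≡ {x = x} {y} x+y≡0 = trans (sym (⊕-cancelʳ x y)) (trans (cong (_⊕ y) x+y≡0) (⊕-identityˡ y))

nonzero-element : {A : Subset n} → AtLeastTwo A → ∃ λ x → x ∈ A × x ≢ 0v
nonzero-element (a , b , a∈A , b∈A , a≢b) with a ≟ᵛ 0v
... | yes a≡0 = b , b∈A , λ b≡0 → a≢b (trans a≡0 (sym b≡0))
... | no  a≢0 = a , a∈A , a≢0

∖∖⁅⁆⇒≡ : (J : Fin m → Bool) {i j : Fin m} → (J ∖ (J ∖ ⁅ j ⁆)) i ≡ true → i ≡ j
∖∖⁅⁆⇒≡ J {i} {j} i∈ = ⁅⁆⇒≡ {i = i} {j} (bool-fact (⁅ j ⁆ i) (J i) i∈)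
  where
  bool-fact : ∀ a b → not (not a ∧ b) ∧ b ≡ true → a ≡ true
  bool-fact true  _ _ = refl
  bool-fact false true ()

span-member : (J : Fin m → Bool) (v : Fin m → F2^ n) {U : List (F2^ n)} {i : Fin m} →
              J i ≡ true → InSpan (members J v ++ U) (v i)
span-member J v {U} {i} i∈J = span-members⁺ J ⁅ i ⁆ v
  (subst (InSpan U) (sym (trans (cong (v i ⊕_) (lincomb-single J v i∈J)) (⊕-self (v i)))) (span-0 U))

module _ (S : Fin m → Subset n) (0∈S : ∀ i → 0v ∈ S i) (S-large : ∀ i → AtLeastTwo (S i)) where

  sumset⊆span : (U : List (F2^ n)) (J : Fin m → Bool) {x : F2^ n} → Spans S U J → InSumset S J x → InSpan U x
  sumset⊆span U J J-spanned (s , s∈S , refl) =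
    span-Σv U _ (λ i → span-· U (J i) (λ i∈J → J-spanned i i∈J (s i) (s∈S i i∈J)))

  span⊆sumset : {K J : Fin m → Bool} (B : Fin m → F2^ n) {x : F2^ n} → K ⊆ J → IsTransversal S K B →
                InSpan (members K B ++ []) x → InSumset S J x
  span⊆sumset {K} {J} B {x} K⊆J B∈S x∈ with span-members⁻ K B x∈
  ... | c , x+Σ≡0 = s , s∈S , trans (⊕≡0⇒≡ x+Σ≡0) (Σv-cong term)
    where
    s : Fin m → F2^ n
    s i = if K i ∧ c i then B i else 0v
    s∈S : ∀ i → J i ≡ true → s i ∈ S i
    s∈S i _ with K i ∧ c i in i∈
    ... | true  = B∈S i (∧-elimˡ (K i) i∈)
    ... | false = 0∈S i
    term : ∀ i → (K i ∧ c i) · B i ≡ J i · s i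
    term i with K i ∧ c i in i∈
    ... | true  rewrite K⊆J i (∧-elimˡ (K i) i∈) = refl
    ... | false = sym (if-eta (J i))

  element∈sumset : {J : Fin m → Bool} {j : Fin m} {x : F2^ n} → J j ≡ true → x ∈ S j → InSumset S J x
  element∈sumset {J} {j} {x} j∈J x∈S = s , s∈S , sym (trans (Σv-single _ j other≡0) at-j)
    where
    s : Fin m → F2^ n
    s = mix ⁅ j ⁆ (λ _ → x) (λ _ → 0v)
    s∈S : ∀ i → J i ≡ true → s i ∈ S i
    s∈S i _ with ⁅ j ⁆ i in i∈⁅j⁆
    ... | true  = subst (λ k → x ∈ S k) (sym (⁅⁆⇒≡ {i = i} {j} i∈⁅j⁆)) x∈S
    ... | false = 0∈S i
    other≡0 : ∀ i → i ≢ j → J i · s i ≡ 0v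
    other≡0 i i≢j rewrite ⁅⁆-other {i = i} {j} i≢j = if-eta (J i)
    at-j : J j · s j ≡ x
    at-j rewrite j∈J | ⁅⁆-self j = refl

  sumset-isNontrivialSubspace : (U : List (F2^ n)) {J : Fin m → Bool} {j : Fin m} → J j ≡ true →
                                (∀ {x} → InSumset S J x → InSpan U x) → (∀ {x} → InSpan U x → InSumset S J x) →
                                IsNontrivialSubspace (InSumset S J)
  sumset-isNontrivialSubspace U {j = j} j∈J to-span from-span =
    (from-span (span-0 U) , λ _ _ x∈ y∈ → from-span (span-⊕ U (to-span x∈) (to-span y∈))) , nonzero
    where
    nonzero : ∃ λ x → InSumset S _ x × x ≢ 0v
    nonzero with nonzero-element (S-large j)
    ... | x , x∈S , x≢0 = x , element∈sumset j∈J x∈S , x≢0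

  independent-transversal-spans :
    {K : Fin m → Bool} {j : Fin m} (T : List (F2^ n)) → length T < ∣ K ∣ → Spans S (T ++ []) K →
    (B : Fin m → F2^ n) → IsTransversal S (K ∖ ⁅ j ⁆) B → IndependentMod [] (K ∖ ⁅ j ⁆) B →
    Spans S (members (K ∖ ⁅ j ⁆) B ++ []) K
  independent-transversal-spans {K} {j} T short K-spanned B B∈S B-ind i i∈K s s∈S
    with span? (members (K ∖ ⁅ j ⁆) B ++ []) s
  ... | yes s∈ = s∈
  ... | no s∉ = contradiction (dimension-bound T [] K (mix K⁻ B (λ _ → s)) independent in-span) (<⇒≱ short)
    where
    K⁻ = K ∖ ⁅ j ⁆
    independent : IndependentMod [] K (mix K⁻ B (λ _ → s))
    independent = independent-mix (members K⁻ B) [] (∖-⊆ K ⁅ j ⁆) B-ind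
                    (independent-const (K ∖ K⁻) (λ _ → ∖∖⁅⁆⇒≡ K) s∉) (λ _ → span-member K⁻ B)
    in-span : ∀ k → K k ≡ true → InSpan (T ++ []) (mix K⁻ B (λ _ → s) k)
    in-span k k∈K with K⁻ k in k∈K⁻
    ... | true  = K-spanned k k∈K (B k) (B∈S k k∈K⁻)
    ... | false = K-spanned i i∈K s s∈S

  subspace-from-deficient : (K : Fin m → Bool) → Acc _≺_ K → Deficient S [] K →
                            ∃ λ J → IsNontrivialSubspace (InSumset S J)
  subspace-from-deficient K (acc smaller) (T , short , K-spanned) with any? (λ j → K j ≟ᵇ true)
  ... | no K-empty =
    contradiction (subst (length T <_) (∣∣-empty K (λ i → ¬-not λ i∈K → K-empty (i , i∈K))) short) λ ()
  ... | yes (j , j∈K) with rado S (K ∖ ⁅ j ⁆) (≺-wellFounded _) []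
  ...   | inj₂ (K′ , K′⊆ , K′-deficient) =
    subspace-from-deficient K′ (smaller (≤-<-trans (∣∣-mono K′⊆) (∖⁅⁆-≺ K j∈K))) K′-deficient
  ...   | inj₁ (B , B∈S , B-ind) =
    K , sumset-isNontrivialSubspace L j∈K
          (sumset⊆span L K (independent-transversal-spans T short K-spanned B B∈S B-ind))
          (span⊆sumset B (∖-⊆ K ⁅ j ⁆) B∈S)
    where L = members (K ∖ ⁅ j ⁆) B ++ []

propositionA2 : (n : ℕ) → 1 ≤ n → (m : ℕ) → (S : Fin m → Subset n)
    → (∀ i → 0v ∈ S i) → (∀ i → AtLeastTwo (S i))
    → (∀ (v : Fin m → F2^ n) → (∀ i → v i ∈ S i) → ¬ LinIndependent v)
    → Σ (Fin m → Bool) λ J → IsNontrivialSubspace (InSumset S J)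
propositionA2 n _ m S 0∈S S-large dependent with rado S (λ _ → true) (≺-wellFounded _) []
... | inj₁ (v , v∈S , v-independent) =
  ⊥-elim (dependent v (λ i → v∈S i refl) (λ c Σ≡0 i → v-independent c Σ≡0 i refl))
... | inj₂ (K , _ , K-deficient) = subspace-from-deficient S 0∈S S-large K (≺-wellFounded K) K-deficient
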